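{- Let $M$ be a $3$-connected matroid. Let $C = \{e,f,g,h\}$ be a $4$-element circuit of $M$ such that $\{g,h\}$ is contained in a triad of $M$. If $e$ is not contained in a triad and $M / f$ is $3$-connected, then $M \backslash e$ is $3$-connected.
   Context: A triad is a 3-element cocircuit. -}

module Defs where

open import Data.Nat using (ℕ; _+_; _∸_; _≤_; _<_)
open import Data.Fin using (Fin)
open import Data.Fin.Subset using (Subset; _⊆_; _⊂_; _∪_; _∩_; _─_; ∁; ⁅_⁆; ∣_∣; _∈_; _∉_; ⊤)
open import Data.Product using (_×_; Σ; ∃)
open import Relation.Nullary using (¬_)

record Matroid (n : ℕ) : Set where
  field
    r       : Subset n → ℕ
    r-bound : ∀ X → r X ≤ ∣ X ∣
    r-mono  : ∀ X Y → X ⊆ Y → r X ≤ r Y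
    r-submod : ∀ X Y → r (X ∪ Y) + r (X ∩ Y) ≤ r X + r Y

open Matroid public

module _ {n : ℕ} (M : Matroid n) where

  Independent : Subset n → Set
  Independent X = r M X ≡ ∣ X ∣
    where open import Relation.Binary.PropositionalEquality using (_≡_)

  Dependent : Subset n → Set
  Dependent X = r M X < ∣ X ∣

  IsCircuit : Subset n → Set
  IsCircuit C = Dependent C × (∀ Y → Y ⊂ C → ¬ Dependent Y)

  dualRank : Subset n → ℕ
  dualRank X = (∣ X ∣ + r M (∁ X)) ∸ r M ⊤

  IsCocircuit : Subset n → Set
  IsCocircuit C = (dualRank C < ∣ C ∣) × (∀ Y → Y ⊂ C → ¬ (dualRank Y < ∣ Y ∣))

  IsTriad : Subset n → Set
  IsTriad T = IsCocircuit T × ∣ T ∣ ≡ 3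
    where open import Relation.Binary.PropositionalEquality using (_≡_)

-- Connectivity of a matroid given by a rank function ρ on a ground set E ⊆ Fin n
-- (used for minors, whose ground set is a subset of Fin n).
IsSeparation : {n : ℕ} → (Subset n → ℕ) → Subset n → ℕ → Subset n → Set
IsSeparation ρ E k X =
  X ⊆ E × k ≤ ∣ X ∣ × k ≤ ∣ E ─ X ∣ × ((ρ X + ρ (E ─ X)) ∸ ρ E) < k

ThreeConnectedOn : {n : ℕ} → (Subset n → ℕ) → Subset n → Set
ThreeConnectedOn ρ E = ∀ k X → 1 ≤ k → k < 3 → ¬ IsSeparation ρ E k X

ThreeConnected : {n : ℕ} → Matroid n → Set
ThreeConnected M = ThreeConnectedOn (r M) ⊤

ThreeConnectedDel : {n : ℕ} → Matroid n → Fin n → Set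
ThreeConnectedDel M e = ThreeConnectedOn (r M) (∁ ⁅ e ⁆)

contractRank : {n : ℕ} → Matroid n → Fin n → Subset n → ℕ
contractRank M f X = r M (X ∪ ⁅ f ⁆) ∸ r M ⁅ f ⁆

ThreeConnectedCon : {n : ℕ} → Matroid n → Fin n → Set
ThreeConnectedCon M f = ThreeConnectedOn (contractRank M f) (∁ ⁅ f ⁆)

{-# OPTIONS --safe #-}

-- Let (X, Y) be a 2-separation of M \ e (a 1-separation is ruled out by adding e
-- to a side with at least two elements).  Both sides have at least three
-- elements, for otherwise the small side together with e would be a triad
-- containing e.  If f, g, h lie in X, the circuit puts e in the closure of X and
-- (X ∪ e, Y) is a 2-separation of M.  If g, h lie in X and f lies in Y, the
-- circuit puts f in the closure of X ∪ e and (X ∪ e, Y - f) is a 2-separation of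
-- M / f.  If g and h are on different sides, the triad through them meets one
-- side in g or h alone; that element is a coloop of its side, and moving it
-- across leaves a 2-separation with g and h together.

module Submission where

open import Defs
open import Data.Empty using (⊥; ⊥-elim)
open import Data.Fin using (Fin)
open import Data.Fin.Properties using (_≟_; any?)
open import Data.Fin.Subset
  using (Subset; _∪_; _∩_; _─_; _-_; ∁; ⁅_⁆; ∣_∣; _∈_; _∉_; ⊤; _⊆_; _⊂_; inside; outside)
open import Data.Fin.Subset.Properties
  using ( _∈?_; ∈⊤; ⊆⊤; ∣⊤∣≡n; x∈⁅x⁆; x∈⁅y⁆⇒x≡y; x≢y⇒x∉⁅y⁆; x∉⁅y⁆⇒x≢y; ∣⁅x⁆∣≡1
        ; p⊆q⇒∣p∣≤∣q∣; p⊂q⇒∣p∣<∣q∣; x∈p⇒x∉∁p; x∈∁p⇒x∉p; x∉p⇒x∈∁p; p∪∁p≡⊤; ∣∁p∣≡n∸∣p∣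
        ; x∈p∩q⁺; ∪-comm; p⊆p∪q; q⊆p∪q; x∈p∪q⁻; x∈p∪q⁺; ∣p∣≤∣p∪q∣
        ; x∈p∧x∉q⇒x∈p─q; p─q⊆p; x∈p∧x≢y⇒x∈p-y; x∈p⇒p-x⊂p; x∈p⇒∣p-x∣<∣p∣ )
open import Data.List using ([]; _∷_; length)
open import Data.List.Relation.Unary.All as All using (All; []; _∷_)
open import Data.List.Relation.Unary.AllPairs using ([]; _∷_)
open import Data.List.Relation.Unary.Unique.Propositional using (Unique)
open import Data.Nat using (ℕ; zero; suc; _+_; _∸_; _≤_; _<_; z≤n; s≤s; _≤?_; >-nonZero)
open import Data.Nat.Properties hiding (_≟_)
open import Algebra.Properties.CommutativeSemigroup +-commutativeSemigroup using (x∙yz≈y∙xz)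
open import Data.Product using (_×_; ∃; _,_; proj₁; proj₂)
open import Data.Sum as Sum using (_⊎_; inj₁; inj₂)
open import Data.Vec using ([]; _∷_; here; there)
open import Function using (_∘_)
open import Relation.Binary.Core using (_Preserves_⟶_)
open import Relation.Binary.PropositionalEquality
  using (_≡_; _≢_; refl; sym; trans; cong; subst; subst₂; ≢-sym)
open import Relation.Nullary using (¬_; yes; no; ¬?)
open import Relation.Nullary.Decidable using (_×-dec_; decidable-stable)

open ≤-Reasoning

private
  variable
    n k : ℕ
    x y : Fin n
    p q E S T W X Y Z : Subset n

x∈p─q⇒x∉q : ∀ (p q : Subset n) → x ∈ p ─ q → x ∉ q
x∈p─q⇒x∉q {x = Fin.zero}  (inside ∷ p)  (outside ∷ q) here ()
x∈p─q⇒x∉q {x = Fin.zero}  (outside ∷ p) (inside ∷ q)  ()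
x∈p─q⇒x∉q {x = Fin.zero}  (outside ∷ p) (outside ∷ q) ()
x∈p─q⇒x∉q {x = Fin.zero}  (inside ∷ p)  (inside ∷ q)  ()
x∈p─q⇒x∉q {x = Fin.suc x} (_ ∷ p)       (_ ∷ q)       (there x∈p─q) (there x∈q) =
  x∈p─q⇒x∉q p q x∈p─q x∈q

x∈p-y⇒x≢y : ∀ (p : Subset n) → x ∈ p - y → x ≢ y
x∈p-y⇒x≢y {y = y} p x∈p-y refl = x∈p─q⇒x∉q p ⁅ y ⁆ x∈p-y (x∈⁅x⁆ y)

x≢y⇒x∈∁⁅y⁆ : x ≢ y → x ∈ ∁ ⁅ y ⁆
x≢y⇒x∈∁⁅y⁆ = x∉p⇒x∈∁p ∘ x≢y⇒x∉⁅y⁆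

x∈∁⁅y⁆⇒x≢y : x ∈ ∁ ⁅ y ⁆ → x ≢ y
x∈∁⁅y⁆⇒x≢y = x∉⁅y⁆⇒x≢y ∘ x∈∁p⇒x∉p

x∈p⇒0<∣p∣ : x ∈ p → 0 < ∣ p ∣
x∈p⇒0<∣p∣ x∈p = ≤-<-trans z≤n (x∈p⇒∣p-x∣<∣p∣ x∈p)

∪-monoˡ-⊆ : ∀ r → p ⊆ q → p ∪ r ⊆ q ∪ r
∪-monoˡ-⊆ {p = p} r p⊆q = x∈p∪q⁺ ∘ Sum.map₁ p⊆q ∘ x∈p∪q⁻ p r

∪-monoʳ-⊆ : ∀ r → p ⊆ q → r ∪ p ⊆ r ∪ q
∪-monoʳ-⊆ {p = p} r p⊆q = x∈p∪q⁺ ∘ Sum.map₂ p⊆q ∘ x∈p∪q⁻ r p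

x∈p⇒⁅x⁆⊆p : x ∈ p → ⁅ x ⁆ ⊆ p
x∈p⇒⁅x⁆⊆p {x = x} {p = p} x∈p y∈⁅x⁆ = subst (_∈ p) (sym (x∈⁅y⁆⇒x≡y x y∈⁅x⁆)) x∈p

x∈⁅y⁆∪p⁻ : x ∈ ⁅ y ⁆ ∪ p → x ≡ y ⊎ x ∈ p
x∈⁅y⁆∪p⁻ {y = y} {p = p} = Sum.map₁ (x∈⁅y⁆⇒x≡y y) ∘ x∈p∪q⁻ ⁅ y ⁆ p

p-x∪⁅x⁆⊆p : x ∈ p → (p - x) ∪ ⁅ x ⁆ ⊆ p
p-x∪⁅x⁆⊆p {x = x} {p = p} x∈p y∈ with x∈p∪q⁻ (p - x) ⁅ x ⁆ y∈
... | inj₁ y∈p-x = p─q⊆p p ⁅ x ⁆ y∈p-x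
... | inj₂ y∈⁅x⁆ = x∈p⇒⁅x⁆⊆p x∈p y∈⁅x⁆

∣p∪q∣≤∣p∣+∣q∣ : ∀ (p q : Subset n) → ∣ p ∪ q ∣ ≤ ∣ p ∣ + ∣ q ∣
∣p∪q∣≤∣p∣+∣q∣ []            []            = z≤n
∣p∪q∣≤∣p∣+∣q∣ (inside ∷ p)  (inside ∷ q)  =
  s≤s (≤-trans (∣p∪q∣≤∣p∣+∣q∣ p q) (+-monoʳ-≤ ∣ p ∣ (n≤1+n ∣ q ∣)))
∣p∪q∣≤∣p∣+∣q∣ (inside ∷ p)  (outside ∷ q) = s≤s (∣p∪q∣≤∣p∣+∣q∣ p q)
∣p∪q∣≤∣p∣+∣q∣ (outside ∷ p) (inside ∷ q)  =
  ≤-trans (s≤s (∣p∪q∣≤∣p∣+∣q∣ p q)) (≤-reflexive (sym (+-suc ∣ p ∣ ∣ q ∣)))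
∣p∪q∣≤∣p∣+∣q∣ (outside ∷ p) (outside ∷ q) = ∣p∪q∣≤∣p∣+∣q∣ p q

∣p∣≤1+∣p-x∣ : ∀ (p : Subset n) x → ∣ p ∣ ≤ suc ∣ p - x ∣
∣p∣≤1+∣p-x∣ p x = begin
  ∣ p ∣                 ≤⟨ p⊆q⇒∣p∣≤∣q∣ p⊆[p-x]∪⁅x⁆ ⟩
  ∣ (p - x) ∪ ⁅ x ⁆ ∣   ≤⟨ ∣p∪q∣≤∣p∣+∣q∣ (p - x) ⁅ x ⁆ ⟩
  ∣ p - x ∣ + ∣ ⁅ x ⁆ ∣ ≡⟨ cong (∣ p - x ∣ +_) (∣⁅x⁆∣≡1 x) ⟩
  ∣ p - x ∣ + 1         ≡⟨ +-comm ∣ p - x ∣ 1 ⟩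
  suc ∣ p - x ∣         ∎
  where
  p⊆[p-x]∪⁅x⁆ : p ⊆ (p - x) ∪ ⁅ x ⁆
  p⊆[p-x]∪⁅x⁆ {y} y∈p with y ≟ x
  ... | yes refl = q⊆p∪q (p - x) ⁅ x ⁆ (x∈⁅x⁆ x)
  ... | no y≢x   = p⊆p∪q ⁅ x ⁆ (x∈p∧x≢y⇒x∈p-y y∈p y≢x)

x∉p⇒∣p∣<∣p∪⁅x⁆∣ : x ∉ p → ∣ p ∣ < ∣ p ∪ ⁅ x ⁆ ∣
x∉p⇒∣p∣<∣p∪⁅x⁆∣ {x = x} {p = p} x∉p =
  ≤-<-trans (p⊆q⇒∣p∣≤∣q∣ p⊆[p∪⁅x⁆]-x) (x∈p⇒∣p-x∣<∣p∣ (q⊆p∪q p ⁅ x ⁆ (x∈⁅x⁆ x)))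
  where
  p⊆[p∪⁅x⁆]-x : p ⊆ (p ∪ ⁅ x ⁆) - x
  p⊆[p∪⁅x⁆]-x y∈p = x∈p∧x≢y⇒x∈p-y (p⊆p∪q ⁅ x ⁆ y∈p) λ { refl → x∉p y∈p }

unique-length≤∣p∣ : ∀ {xs} → Unique xs → All (_∈ p) xs → length xs ≤ ∣ p ∣
unique-length≤∣p∣ []                []            = z≤n
unique-length≤∣p∣ {p = p} {x ∷ _} (x≢xs ∷ distinct) (x∈p ∷ xs⊆p) =
  ≤-trans (s≤s (unique-length≤∣p∣ distinct (All.zipWith ∈p-x (xs⊆p , x≢xs))))
          (x∈p⇒∣p-x∣<∣p∣ x∈p)
  where
  ∈p-x : ∀ {y} → y ∈ p × x ≢ y → y ∈ p - x
  ∈p-x (y∈p , x≢y) = x∈p∧x≢y⇒x∈p-y y∈p (≢-sym x≢y)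

∣T∣≡3⇒meets-a-side-once : ∀ {g h} → ∣ T ∣ ≡ 3 → (∀ {x} → x ∈ X → x ∉ Y) →
                          g ∈ X → h ∈ Y → g ∈ T → h ∈ T →
                          (∀ {x} → x ∈ X → x ∈ T → x ≡ g) ⊎ (∀ {y} → y ∈ Y → y ∈ T → y ≡ h)
∣T∣≡3⇒meets-a-side-once {T = T} {X} {Y} {g} {h} ∣T∣≡3 disjoint g∈X h∈Y g∈T h∈T
  with any? (λ x → x ∈? X ×-dec x ∈? T ×-dec ¬? (x ≟ g))
... | no ∄x = inj₁ λ {x} x∈X x∈T → decidable-stable (x ≟ g) λ x≢g → ∄x (x , x∈X , x∈T , x≢g)
... | yes (x , x∈X , x∈T , x≢g) = inj₂ λ {y} y∈Y y∈T → decidable-stable (y ≟ h) (four-in-T y∈Y y∈T)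
  where
  apart : ∀ {a b} → a ∈ X → b ∈ Y → a ≢ b
  apart a∈X b∈Y refl = disjoint a∈X b∈Y
  four-in-T : ∀ {y} → y ∈ Y → y ∈ T → y ≢ h → ⊥
  four-in-T {y} y∈Y y∈T y≢h =
    1+n≰n (subst (4 ≤_) ∣T∣≡3 (unique-length≤∣p∣ distinct (x∈T ∷ g∈T ∷ y∈T ∷ h∈T ∷ [])))
    where
    distinct : Unique (x ∷ g ∷ y ∷ h ∷ [])
    distinct = (x≢g ∷ apart x∈X y∈Y ∷ apart x∈X h∈Y ∷ [])
             ∷ (apart g∈X y∈Y ∷ apart g∈X h∈Y ∷ [])
             ∷ (y≢h ∷ [])
             ∷ [] ∷ []

record Partition (E X Y : Subset n) : Set where
  field
    cover    : ∀ {x} → x ∈ E → x ∈ X ⊎ x ∈ Y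
    X⊆E      : X ⊆ E
    Y⊆E      : Y ⊆ E
    disjoint : ∀ {x} → x ∈ X → x ∉ Y

swap-partition : Partition E X Y → Partition E Y X
swap-partition P = record
  { cover = Sum.swap ∘ cover ; X⊆E = Y⊆E ; Y⊆E = X⊆E ; disjoint = λ x∈Y x∈X → disjoint x∈X x∈Y }
  where open Partition P

complement-partition : X ⊆ E → Partition E X (E ─ X)
complement-partition {X = X} {E = E} X⊆E = record
  { cover = cover ; X⊆E = X⊆E ; Y⊆E = p─q⊆p E X ; disjoint = λ x∈X x∈E─X → x∈p─q⇒x∉q E X x∈E─X x∈X }
  where
  cover : ∀ {x} → x ∈ E → x ∈ X ⊎ x ∈ E ─ X
  cover {x} x∈E with x ∈? X
  ... | yes x∈X = inj₁ x∈X
  ... | no  x∉X = inj₂ (x∈p∧x∉q⇒x∈p─q x∈E x∉X)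

∁-partition : ∀ (Z : Subset n) → Partition ⊤ Z (∁ Z)
∁-partition Z = record { cover = cover ; X⊆E = ⊆⊤ ; Y⊆E = ⊆⊤ ; disjoint = x∈p⇒x∉∁p }
  where
  cover : ∀ {x} → x ∈ ⊤ → x ∈ Z ⊎ x ∈ ∁ Z
  cover {x} _ with x ∈? Z
  ... | yes x∈Z = inj₁ x∈Z
  ... | no  x∉Z = inj₂ (x∉p⇒x∈∁p x∉Z)

move : Partition E X Y → y ∈ Y → Partition E (X ∪ ⁅ y ⁆) (Y - y)
move {E = E} {X = X} {Y = Y} {y = y} P y∈Y = record
  { cover = cover′ ; X⊆E = X∪y⊆E ; Y⊆E = Y⊆E ∘ p─q⊆p Y ⁅ y ⁆ ; disjoint = disjoint′ }
  where
  open Partition P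
  cover′ : ∀ {x} → x ∈ E → x ∈ X ∪ ⁅ y ⁆ ⊎ x ∈ Y - y
  cover′ {x} x∈E with x ≟ y | cover x∈E
  ... | yes refl | _        = inj₁ (q⊆p∪q X ⁅ y ⁆ (x∈⁅x⁆ y))
  ... | no  _    | inj₁ x∈X = inj₁ (p⊆p∪q ⁅ y ⁆ x∈X)
  ... | no  x≢y  | inj₂ x∈Y = inj₂ (x∈p∧x≢y⇒x∈p-y x∈Y x≢y)
  X∪y⊆E : X ∪ ⁅ y ⁆ ⊆ E
  X∪y⊆E x∈ with x∈p∪q⁻ X ⁅ y ⁆ x∈
  ... | inj₁ x∈X   = X⊆E x∈X
  ... | inj₂ x∈⁅y⁆ = x∈p⇒⁅x⁆⊆p (Y⊆E y∈Y) x∈⁅y⁆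
  disjoint′ : ∀ {x} → x ∈ X ∪ ⁅ y ⁆ → x ∉ Y - y
  disjoint′ x∈ x∈Y-y with x∈p∪q⁻ X ⁅ y ⁆ x∈
  ... | inj₁ x∈X   = disjoint x∈X (p─q⊆p Y ⁅ y ⁆ x∈Y-y)
  ... | inj₂ x∈⁅y⁆ = x∈p-y⇒x≢y Y x∈Y-y (x∈⁅y⁆⇒x≡y y x∈⁅y⁆)

add-deleted : ∀ {e : Fin n} → Partition (∁ ⁅ e ⁆) X Y → Partition ⊤ (X ∪ ⁅ e ⁆) Y
add-deleted {X = X} {Y = Y} {e = e} P = record
  { cover = cover′ ; X⊆E = ⊆⊤ ; Y⊆E = ⊆⊤ ; disjoint = disjoint′ }
  where
  open Partition P
  cover′ : ∀ {x} → x ∈ ⊤ → x ∈ X ∪ ⁅ e ⁆ ⊎ x ∈ Y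
  cover′ {x} _ with x ≟ e
  ... | yes refl = inj₁ (q⊆p∪q X ⁅ e ⁆ (x∈⁅x⁆ e))
  ... | no  x≢e  = Sum.map₁ (p⊆p∪q ⁅ e ⁆) (cover (x≢y⇒x∈∁⁅y⁆ x≢e))
  disjoint′ : ∀ {x} → x ∈ X ∪ ⁅ e ⁆ → x ∉ Y
  disjoint′ x∈ x∈Y with x∈p∪q⁻ X ⁅ e ⁆ x∈
  ... | inj₁ x∈X   = disjoint x∈X x∈Y
  ... | inj₂ x∈⁅e⁆ = x∈∁⁅y⁆⇒x≢y (Y⊆E x∈Y) (x∈⁅y⁆⇒x≡y e x∈⁅e⁆)

remove-contracted : ∀ {f : Fin n} → Partition ⊤ X Y → f ∈ Y → Partition (∁ ⁅ f ⁆) X (Y - f)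
remove-contracted {X = X} {Y = Y} {f = f} P f∈Y = record
  { cover = cover′ ; X⊆E = X⊆∁f ; Y⊆E = x≢y⇒x∈∁⁅y⁆ ∘ x∈p-y⇒x≢y Y ; disjoint = disjoint′ }
  where
  open Partition P
  cover′ : ∀ {x} → x ∈ ∁ ⁅ f ⁆ → x ∈ X ⊎ x ∈ Y - f
  cover′ x∈∁f = Sum.map₂ (λ x∈Y → x∈p∧x≢y⇒x∈p-y x∈Y (x∈∁⁅y⁆⇒x≢y x∈∁f)) (cover ∈⊤)
  X⊆∁f : X ⊆ ∁ ⁅ f ⁆
  X⊆∁f x∈X = x≢y⇒x∈∁⁅y⁆ λ { refl → disjoint x∈X f∈Y }
  disjoint′ : ∀ {x} → x ∈ X → x ∉ Y - f
  disjoint′ x∈X = disjoint x∈X ∘ p─q⊆p Y ⁅ f ⁆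

-- IsSeparation with the second side given as any set extensionally equal to
-- E ─ X, and the condition λ < k stated without truncated subtraction.
record Separation (ρ : Subset n → ℕ) (E : Subset n) (k : ℕ) (X Y : Subset n) : Set where
  field
    partition  : Partition E X Y
    k≤∣X∣      : k ≤ ∣ X ∣
    k≤∣Y∣      : k ≤ ∣ Y ∣
    ρX+ρY<ρE+k : ρ X + ρ Y < ρ E + k

swap-separation : ∀ {ρ} → Separation ρ E k X Y → Separation ρ E k Y X
swap-separation {E = E} {k = k} {X = X} {Y = Y} {ρ = ρ} S = record
  { partition  = swap-partition partition
  ; k≤∣X∣      = k≤∣Y∣
  ; k≤∣Y∣      = k≤∣X∣
  ; ρX+ρY<ρE+k = subst (_< ρ E + k) (+-comm (ρ X) (ρ Y)) ρX+ρY<ρE+k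
  }
  where open Separation S

IsSeparation⇒Separation : ∀ {ρ} → IsSeparation ρ E k X → Separation ρ E k X (E ─ X)
IsSeparation⇒Separation {E = E} {X = X} {ρ = ρ} (X⊆E , k≤∣X∣ , k≤∣E─X∣ , connectivity<k) = record
  { partition  = complement-partition X⊆E
  ; k≤∣X∣      = k≤∣X∣
  ; k≤∣Y∣      = k≤∣E─X∣
  ; ρX+ρY<ρE+k = ≤-<-trans (m≤n+m∸n (ρ X + ρ (E ─ X)) (ρ E)) (+-monoʳ-< (ρ E) connectivity<k)
  }

¬Separation : ∀ {ρ} → ρ Preserves _⊆_ ⟶ _≤_ → ThreeConnectedOn ρ E →
              1 ≤ k → k < 3 → ¬ Separation ρ E k X Y
¬Separation {E = E} {k = suc k} {X = X} {Y = Y} {ρ = ρ} ρ-mono 3-connected 1≤k k<3 S =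
  3-connected (suc k) X 1≤k k<3
    (X⊆E , k≤∣X∣ , ≤-trans k≤∣Y∣ (p⊆q⇒∣p∣≤∣q∣ Y⊆E─X) , connectivity<k)
  where
  open Separation S
  open Partition partition
  Y⊆E─X : Y ⊆ E ─ X
  Y⊆E─X y∈Y = x∈p∧x∉q⇒x∈p─q (Y⊆E y∈Y) (λ y∈X → disjoint y∈X y∈Y)
  E─X⊆Y : E ─ X ⊆ Y
  E─X⊆Y x∈E─X with cover (p─q⊆p E X x∈E─X)
  ... | inj₁ x∈X = ⊥-elim (x∈p─q⇒x∉q E X x∈E─X x∈X)
  ... | inj₂ x∈Y = x∈Y
  connectivity<k : (ρ X + ρ (E ─ X)) ∸ ρ E < suc k
  connectivity<k = m<n+o⇒m∸n<o (ρ X + ρ (E ─ X)) (ρ E)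
    (≤-<-trans (+-monoʳ-≤ (ρ X) (ρ-mono E─X⊆Y)) ρX+ρY<ρE+k)

m+n<o+[p+k]⇒[m∸o]+[n∸o]<[p∸o]+k : ∀ o {m n p k} → o ≤ m → o ≤ n → o ≤ p →
                                  m + n < o + (p + k) → (m ∸ o) + (n ∸ o) < (p ∸ o) + k
m+n<o+[p+k]⇒[m∸o]+[n∸o]<[p∸o]+k zero    _         _         _         m+n<p+k = m+n<p+k
m+n<o+[p+k]⇒[m∸o]+[n∸o]<[p∸o]+k (suc o) {suc m} {suc n} {suc p} {k}
  (s≤s o≤m) (s≤s o≤n) (s≤s o≤p) m+n<o+[p+k] =
  m+n<o+[p+k]⇒[m∸o]+[n∸o]<[p∸o]+k o o≤m o≤n o≤p
    (≤-pred (subst₂ _≤_ (cong suc (+-suc m n)) (+-suc o (p + k)) (≤-pred m+n<o+[p+k])))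

module _ (M : Matroid n) where

  r-mono-⊆ : r M Preserves _⊆_ ⟶ _≤_
  r-mono-⊆ {X} {Y} = r-mono M X Y

  contractRank-mono-⊆ : ∀ f → contractRank M f Preserves _⊆_ ⟶ _≤_
  contractRank-mono-⊆ f X⊆Y = ∸-monoˡ-≤ (r M ⁅ f ⁆) (r-mono-⊆ (∪-monoˡ-⊆ ⁅ f ⁆ X⊆Y))

  r[X∪x]≤1+r[X] : ∀ X x → r M (X ∪ ⁅ x ⁆) ≤ suc (r M X)
  r[X∪x]≤1+r[X] X x = begin
    r M (X ∪ ⁅ x ⁆)                   ≤⟨ m≤m+n _ _ ⟩
    r M (X ∪ ⁅ x ⁆) + r M (X ∩ ⁅ x ⁆) ≤⟨ r-submod M X ⁅ x ⁆ ⟩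
    r M X + r M ⁅ x ⁆                 ≤⟨ +-monoʳ-≤ (r M X) (r-bound M ⁅ x ⁆) ⟩
    r M X + ∣ ⁅ x ⁆ ∣                 ≡⟨ cong (r M X +_) (∣⁅x⁆∣≡1 x) ⟩
    r M X + 1                         ≡⟨ +-comm (r M X) 1 ⟩
    suc (r M X)                       ∎

  circuit-minimal : ∀ {C} → IsCircuit M C → Y ⊂ C → ∣ Y ∣ ≤ r M Y
  circuit-minimal (_ , minimal) Y⊂C = ≮⇒≥ (minimal _ Y⊂C)

  circuit-closure : ∀ {C} → IsCircuit M C → x ∈ C → C - x ⊆ S → r M (S ∪ ⁅ x ⁆) ≤ r M S
  circuit-closure {x = x} {S = S} {C} C-circuit@(C-dependent , _) x∈C C-x⊆S = begin
    r M (S ∪ ⁅ x ⁆) ≤⟨ r-mono-⊆ (∪-monoʳ-⊆ S (x∈p⇒⁅x⁆⊆p x∈C)) ⟩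
    r M (S ∪ C)     ≤⟨ +-cancelʳ-≤ (r M C) _ _ (begin
      r M (S ∪ C) + r M C       ≤⟨ +-monoʳ-≤ (r M (S ∪ C)) r[C]≤r[S∩C] ⟩
      r M (S ∪ C) + r M (S ∩ C) ≤⟨ r-submod M S C ⟩
      r M S + r M C             ∎) ⟩
    r M S           ∎
    where
    r[C]≤r[S∩C] : r M C ≤ r M (S ∩ C)
    r[C]≤r[S∩C] = begin
      r M C       ≤⟨ ≤-pred (≤-trans C-dependent (∣p∣≤1+∣p-x∣ C x)) ⟩
      ∣ C - x ∣   ≤⟨ circuit-minimal C-circuit (x∈p⇒p-x⊂p x∈C) ⟩
      r M (C - x) ≤⟨ r-mono-⊆ (λ y∈C-x → x∈p∩q⁺ (C-x⊆S y∈C-x , p─q⊆p C ⁅ x ⁆ y∈C-x)) ⟩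
      r M (S ∩ C) ∎

  cospanning⇒¬codependent : r M ⊤ ≤ r M (∁ X) → ¬ (dualRank M X < ∣ X ∣)
  cospanning⇒¬codependent {X = X} r⊤≤r[∁X] = ≤⇒≯ (begin
    ∣ X ∣                            ≡⟨ sym (m+n∸n≡m ∣ X ∣ (r M ⊤)) ⟩
    (∣ X ∣ + r M ⊤) ∸ r M ⊤          ≤⟨ ∸-monoˡ-≤ (r M ⊤) (+-monoʳ-≤ ∣ X ∣ r⊤≤r[∁X]) ⟩
    dualRank M X                     ∎)

  codependent⇒r[∁X]<r⊤ : dualRank M X < ∣ X ∣ → r M (∁ X) < r M ⊤
  codependent⇒r[∁X]<r⊤ codependent = ≰⇒> (λ r⊤≤r[∁X] → cospanning⇒¬codependent r⊤≤r[∁X] codependent)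

  r[∁X]<r⊤⇒codependent : 0 < ∣ X ∣ → r M (∁ X) < r M ⊤ → dualRank M X < ∣ X ∣
  r[∁X]<r⊤⇒codependent {X = X} 0<∣X∣ r[∁X]<r⊤ =
    m<n+o⇒m∸n<o (∣ X ∣ + r M (∁ X)) (r M ⊤) {{>-nonZero 0<∣X∣}}
      (subst (∣ X ∣ + r M (∁ X) <_) (+-comm ∣ X ∣ (r M ⊤)) (+-monoʳ-< ∣ X ∣ r[∁X]<r⊤))

  cocircuit-minimal : IsCocircuit M T → Y ⊂ T → 0 < ∣ Y ∣ → r M ⊤ ≤ r M (∁ Y)
  cocircuit-minimal (_ , minimal) Y⊂T 0<∣Y∣ =
    ≮⇒≥ (λ r[∁Y]<r⊤ → minimal _ Y⊂T (r[∁X]<r⊤⇒codependent 0<∣Y∣ r[∁Y]<r⊤))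

  cocircuit-meeting-once⇒coloop : ∀ {w} → IsCocircuit M T → w ∈ T → 0 < ∣ T - w ∣ →
                                  w ∈ W → (∀ {x} → x ∈ W → x ∈ T → x ≡ w) → r M (W - w) < r M W
  cocircuit-meeting-once⇒coloop {T = T} {W = W} {w} T-cocircuit w∈T 0<∣T-w∣ w∈W W∩T⊆w =
    +-cancelʳ-< (r M ⊤) (r M (W - w)) (r M W) (begin-strict
      r M (W - w) + r M ⊤           ≤⟨ +-mono-≤ (r-mono-⊆ W-w⊆W∩∁T) r⊤≤r[W∪∁T] ⟩
      r M (W ∩ ∁ T) + r M (W ∪ ∁ T) ≡⟨ +-comm (r M (W ∩ ∁ T)) (r M (W ∪ ∁ T)) ⟩
      r M (W ∪ ∁ T) + r M (W ∩ ∁ T) ≤⟨ r-submod M W (∁ T) ⟩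
      r M W + r M (∁ T)             <⟨ +-monoʳ-< (r M W) (codependent⇒r[∁X]<r⊤ (proj₁ T-cocircuit)) ⟩
      r M W + r M ⊤                 ∎)
    where
    W-w⊆W∩∁T : W - w ⊆ W ∩ ∁ T
    W-w⊆W∩∁T {x} x∈W-w = x∈p∩q⁺ (x∈W , x∉p⇒x∈∁p (x∈p-y⇒x≢y W x∈W-w ∘ W∩T⊆w x∈W))
      where
      x∈W : x ∈ W
      x∈W = p─q⊆p W ⁅ w ⁆ x∈W-w
    ∁[T-w]⊆W∪∁T : ∁ (T - w) ⊆ W ∪ ∁ T
    ∁[T-w]⊆W∪∁T {x} x∈∁[T-w] with x ∈? T | x ≟ w
    ... | no  x∉T | _        = q⊆p∪q W (∁ T) (x∉p⇒x∈∁p x∉T)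
    ... | yes _   | yes refl = p⊆p∪q (∁ T) w∈W
    ... | yes x∈T | no  x≢w  = ⊥-elim (x∈∁p⇒x∉p x∈∁[T-w] (x∈p∧x≢y⇒x∈p-y x∈T x≢w))
    r⊤≤r[W∪∁T] : r M ⊤ ≤ r M (W ∪ ∁ T)
    r⊤≤r[W∪∁T] = ≤-trans (cocircuit-minimal T-cocircuit (x∈p⇒p-x⊂p w∈T) 0<∣T-w∣) (r-mono-⊆ ∁[T-w]⊆W∪∁T)

  extend-by-deleted : ∀ {e j} → Separation (r M) (∁ ⁅ e ⁆) k X Y →
                      r M (X ∪ ⁅ e ⁆) ≤ j + r M X → j ≤ 1 → j + k ≤ ∣ Y ∣ →
                      Separation (r M) ⊤ (j + k) (X ∪ ⁅ e ⁆) Y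
  extend-by-deleted {k = k} {X = X} {Y = Y} {e} {j} S r[X∪e]≤j+r[X] j≤1 j+k≤∣Y∣ = record
    { partition  = add-deleted partition
    ; k≤∣X∣      = ≤-trans (+-monoˡ-≤ k j≤1) (≤-trans (s≤s k≤∣X∣) (x∉p⇒∣p∣<∣p∪⁅x⁆∣ e∉X))
    ; k≤∣Y∣      = j+k≤∣Y∣
    ; ρX+ρY<ρE+k = begin-strict
        r M (X ∪ ⁅ e ⁆) + r M Y ≤⟨ +-monoˡ-≤ (r M Y) r[X∪e]≤j+r[X] ⟩
        j + r M X + r M Y       ≡⟨ +-assoc j (r M X) (r M Y) ⟩
        j + (r M X + r M Y)     <⟨ +-monoʳ-< j ρX+ρY<ρE+k ⟩
        j + (r M (∁ ⁅ e ⁆) + k) ≤⟨ +-monoʳ-≤ j (+-monoˡ-≤ k (r-mono-⊆ ⊆⊤)) ⟩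
        j + (r M ⊤ + k)         ≡⟨ x∙yz≈y∙xz j (r M ⊤) k ⟩
        r M ⊤ + (j + k)         ∎
    }
    where
    open Separation S
    e∉X : e ∉ X
    e∉X e∈X = x∈∁⁅y⁆⇒x≢y (Partition.X⊆E partition e∈X) refl

  move-coloop : Separation (r M) E k X Y → y ∈ Y → r M (Y - y) < r M Y → k ≤ ∣ Y - y ∣ →
                Separation (r M) E k (X ∪ ⁅ y ⁆) (Y - y)
  move-coloop {E = E} {k = k} {X = X} {Y = Y} {y = y} S y∈Y coloop k≤∣Y-y∣ = record
    { partition  = move partition y∈Y
    ; k≤∣X∣      = ≤-trans k≤∣X∣ (∣p∣≤∣p∪q∣ X ⁅ y ⁆)
    ; k≤∣Y∣      = k≤∣Y-y∣
    ; ρX+ρY<ρE+k = begin-strict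
        r M (X ∪ ⁅ y ⁆) + r M (Y - y) ≤⟨ +-monoˡ-≤ (r M (Y - y)) (r[X∪x]≤1+r[X] X y) ⟩
        suc (r M X) + r M (Y - y)     ≡⟨ sym (+-suc (r M X) (r M (Y - y))) ⟩
        r M X + suc (r M (Y - y))     ≤⟨ +-monoʳ-≤ (r M X) coloop ⟩
        r M X + r M Y                 <⟨ ρX+ρY<ρE+k ⟩
        r M E + k                     ∎
    }
    where open Separation S

  contraction-separation : ∀ {f} → Partition (∁ ⁅ f ⁆) X Y → k ≤ ∣ X ∣ → k ≤ ∣ Y ∣ →
                           r M (X ∪ ⁅ f ⁆) + r M (Y ∪ ⁅ f ⁆) < r M ⁅ f ⁆ + (r M ⊤ + k) →
                           Separation (contractRank M f) (∁ ⁅ f ⁆) k X Y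
  contraction-separation {X = X} {Y = Y} {k = k} {f} P k≤∣X∣ k≤∣Y∣ rank-bound = record
    { partition  = P
    ; k≤∣X∣      = k≤∣X∣
    ; k≤∣Y∣      = k≤∣Y∣
    ; ρX+ρY<ρE+k = m+n<o+[p+k]⇒[m∸o]+[n∸o]<[p∸o]+k (r M ⁅ f ⁆)
        (r-mono-⊆ (q⊆p∪q X ⁅ f ⁆)) (r-mono-⊆ (q⊆p∪q Y ⁅ f ⁆)) (r-mono-⊆ (q⊆p∪q (∁ ⁅ f ⁆) ⁅ f ⁆))
        (<-≤-trans rank-bound (+-monoʳ-≤ (r M ⁅ f ⁆) (+-monoˡ-≤ k r⊤≤r[∁f∪f])))
    }
    where
    r⊤≤r[∁f∪f] : r M ⊤ ≤ r M (∁ ⁅ f ⁆ ∪ ⁅ f ⁆)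
    r⊤≤r[∁f∪f] = ≤-reflexive (cong (r M) (trans (sym (p∪∁p≡⊤ ⁅ f ⁆)) (∪-comm ⁅ f ⁆ (∁ ⁅ f ⁆))))

module ThreeConnectedMatroid (M : Matroid n) (M-3conn : ThreeConnected M) (4≤n : 4 ≤ n) where

  ¬separation : 1 ≤ k → k < 3 → ¬ Separation (r M) ⊤ k X Y
  ¬separation = ¬Separation (r-mono-⊆ M) M-3conn

  small-set-connectivity : 0 < ∣ Z ∣ → ∣ Z ∣ ≤ 2 → ∣ Z ∣ + r M ⊤ ≤ r M Z + r M (∁ Z)
  small-set-connectivity {Z = Z} 0<∣Z∣ ∣Z∣≤2 = ≮⇒≥ λ rank-sum< →
    ¬separation 0<∣Z∣ (s≤s ∣Z∣≤2) record
      { partition  = ∁-partition Z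
      ; k≤∣X∣      = ≤-refl
      ; k≤∣Y∣      = ≤-trans ∣Z∣≤2 (subst (2 ≤_) (sym (∣∁p∣≡n∸∣p∣ Z)) (∸-mono 4≤n ∣Z∣≤2))
      ; ρX+ρY<ρE+k = subst (r M Z + r M (∁ Z) <_) (+-comm ∣ Z ∣ (r M ⊤)) rank-sum<
      }

  small-set-independent : 0 < ∣ Z ∣ → ∣ Z ∣ ≤ 2 → ∣ Z ∣ ≤ r M Z
  small-set-independent {Z = Z} 0<∣Z∣ ∣Z∣≤2 = +-cancelʳ-≤ (r M ⊤) ∣ Z ∣ (r M Z)
    (≤-trans (small-set-connectivity 0<∣Z∣ ∣Z∣≤2) (+-monoʳ-≤ (r M Z) (r-mono-⊆ M ⊆⊤)))

  small-set-cospanning : 0 < ∣ Z ∣ → ∣ Z ∣ ≤ 2 → r M ⊤ ≤ r M (∁ Z)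
  small-set-cospanning {Z = Z} 0<∣Z∣ ∣Z∣≤2 = +-cancelˡ-≤ ∣ Z ∣ (r M ⊤) (r M (∁ Z))
    (≤-trans (small-set-connectivity 0<∣Z∣ ∣Z∣≤2) (+-monoˡ-≤ (r M (∁ Z)) (r-bound M Z)))

  nonspanning-complement⇒triad : ∣ T ∣ ≡ 3 → r M (∁ T) < r M ⊤ → IsTriad M T
  nonspanning-complement⇒triad {T = T} ∣T∣≡3 r[∁T]<r⊤ =
    (r[∁X]<r⊤⇒codependent M (subst (0 <_) (sym ∣T∣≡3) (s≤s z≤n)) r[∁T]<r⊤ , minimal) , ∣T∣≡3
    where
    minimal : ∀ Z → Z ⊂ T → ¬ (dualRank M Z < ∣ Z ∣)
    minimal Z Z⊂T codependent = cospanning⇒¬codependent M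
      (small-set-cospanning (≤-<-trans z≤n codependent)
                            (≤-pred (subst (∣ Z ∣ <_) ∣T∣≡3 (p⊂q⇒∣p∣<∣q∣ Z⊂T))))
      codependent

module Lemma5p3 (M : Matroid n) {e f g h : Fin n} (M-3conn : ThreeConnected M)
  (e≢f : e ≢ f) (e≢g : e ≢ g) (e≢h : e ≢ h) (f≢g : f ≢ g) (f≢h : f ≢ h) (g≢h : g ≢ h)
  (C-circuit : IsCircuit M (⁅ e ⁆ ∪ ⁅ f ⁆ ∪ ⁅ g ⁆ ∪ ⁅ h ⁆))
  (T-triad : IsTriad M T) (g∈T : g ∈ T) (h∈T : h ∈ T)
  (e∉triads : ∀ T → IsTriad M T → e ∉ T)
  (M/f-3conn : ThreeConnectedCon M f) where

  C : Subset n
  C = ⁅ e ⁆ ∪ ⁅ f ⁆ ∪ ⁅ g ⁆ ∪ ⁅ h ⁆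

  4≤n : 4 ≤ n
  4≤n = subst (4 ≤_) (∣⊤∣≡n n) (unique-length≤∣p∣ distinct (∈⊤ ∷ ∈⊤ ∷ ∈⊤ ∷ ∈⊤ ∷ []))
    where
    distinct : Unique (e ∷ f ∷ g ∷ h ∷ [])
    distinct = (e≢f ∷ e≢g ∷ e≢h ∷ []) ∷ (f≢g ∷ f≢h ∷ []) ∷ (g≢h ∷ []) ∷ [] ∷ []

  open ThreeConnectedMatroid M M-3conn 4≤n

  ∈C : ∀ {x} → x ∈ C → x ≡ e ⊎ x ≡ f ⊎ x ≡ g ⊎ x ≡ h
  ∈C = Sum.map₂ (Sum.map₂ (Sum.map₂ (x∈⁅y⁆⇒x≡y h) ∘ x∈⁅y⁆∪p⁻) ∘ x∈⁅y⁆∪p⁻) ∘ x∈⁅y⁆∪p⁻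

  e∈C : e ∈ C
  e∈C = p⊆p∪q (⁅ f ⁆ ∪ ⁅ g ⁆ ∪ ⁅ h ⁆) (x∈⁅x⁆ e)

  f∈C : f ∈ C
  f∈C = q⊆p∪q ⁅ e ⁆ _ (p⊆p∪q (⁅ g ⁆ ∪ ⁅ h ⁆) (x∈⁅x⁆ f))

  e-spanned : f ∈ S → g ∈ S → h ∈ S → r M (S ∪ ⁅ e ⁆) ≤ r M S
  e-spanned {S = S} f∈S g∈S h∈S = circuit-closure M C-circuit e∈C C-e⊆S
    where
    C-e⊆S : C - e ⊆ S
    C-e⊆S x∈C-e with ∈C (p─q⊆p C ⁅ e ⁆ x∈C-e)
    ... | inj₁ refl               = ⊥-elim (x∈p-y⇒x≢y C x∈C-e refl)
    ... | inj₂ (inj₁ refl)        = f∈S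
    ... | inj₂ (inj₂ (inj₁ refl)) = g∈S
    ... | inj₂ (inj₂ (inj₂ refl)) = h∈S

  f-spanned : e ∈ S → g ∈ S → h ∈ S → r M (S ∪ ⁅ f ⁆) ≤ r M S
  f-spanned {S = S} e∈S g∈S h∈S = circuit-closure M C-circuit f∈C C-f⊆S
    where
    C-f⊆S : C - f ⊆ S
    C-f⊆S x∈C-f with ∈C (p─q⊆p C ⁅ f ⁆ x∈C-f)
    ... | inj₁ refl               = e∈S
    ... | inj₂ (inj₁ refl)        = ⊥-elim (x∈p-y⇒x≢y C x∈C-f refl)
    ... | inj₂ (inj₂ (inj₁ refl)) = g∈S
    ... | inj₂ (inj₂ (inj₂ refl)) = h∈S

  f-nonloop : 1 ≤ r M ⁅ f ⁆
  f-nonloop = subst (_≤ r M ⁅ f ⁆) (∣⁅x⁆∣≡1 f) (circuit-minimal M C-circuit ⁅f⁆⊂C)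
    where
    ⁅f⁆⊂C : ⁅ f ⁆ ⊂ C
    ⁅f⁆⊂C = x∈p⇒⁅x⁆⊆p f∈C , e , e∈C , x≢y⇒x∉⁅y⁆ e≢f

  2-Separation : Subset n → Subset n → Set
  2-Separation = Separation (r M) (∁ ⁅ e ⁆) 2

  side : Separation (r M) (∁ ⁅ e ⁆) k X Y → x ≢ e → x ∈ X ⊎ x ∈ Y
  side S = Partition.cover (Separation.partition S) ∘ x≢y⇒x∈∁⁅y⁆

  2-separation-wide : 2-Separation X Y → 3 ≤ ∣ Y ∣
  2-separation-wide {X = X} {Y = Y} S with 3 ≤? ∣ Y ∣
  ... | yes 3≤∣Y∣ = 3≤∣Y∣
  ... | no  3≰∣Y∣ = ⊥-elim (e∉triads (Y ∪ ⁅ e ⁆) (nonspanning-complement⇒triad ∣Y∪e∣≡3 r[∁[Y∪e]]<r⊤)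
                                     (q⊆p∪q Y ⁅ e ⁆ (x∈⁅x⁆ e)))
    where
    open Separation S
    open Partition partition
    ∣Y∣≤2 : ∣ Y ∣ ≤ 2
    ∣Y∣≤2 = ≤-pred (≰⇒> 3≰∣Y∣)
    e∉Y : e ∉ Y
    e∉Y e∈Y = x∈∁⁅y⁆⇒x≢y (Y⊆E e∈Y) refl
    ∣Y∪e∣≡3 : ∣ Y ∪ ⁅ e ⁆ ∣ ≡ 3
    ∣Y∪e∣≡3 = ≤-antisym
      (≤-trans (∣p∪q∣≤∣p∣+∣q∣ Y ⁅ e ⁆) (+-mono-≤ ∣Y∣≤2 (≤-reflexive (∣⁅x⁆∣≡1 e))))
      (≤-trans (s≤s k≤∣Y∣) (x∉p⇒∣p∣<∣p∪⁅x⁆∣ e∉Y))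
    ∣Y∣≤r[Y] : ∣ Y ∣ ≤ r M Y
    ∣Y∣≤r[Y] = small-set-independent (≤-trans (s≤s z≤n) k≤∣Y∣) ∣Y∣≤2
    r[X]<r⊤ : r M X < r M ⊤
    r[X]<r⊤ = +-cancelʳ-< 2 (r M X) (r M ⊤) (begin-strict
      r M X + 2             ≤⟨ +-monoʳ-≤ (r M X) (≤-trans k≤∣Y∣ ∣Y∣≤r[Y]) ⟩
      r M X + r M Y         <⟨ ρX+ρY<ρE+k ⟩
      r M (∁ ⁅ e ⁆) + 2     ≤⟨ +-monoˡ-≤ 2 (r-mono-⊆ M ⊆⊤) ⟩
      r M ⊤ + 2             ∎)
    ∁[Y∪e]⊆X : ∁ (Y ∪ ⁅ e ⁆) ⊆ X
    ∁[Y∪e]⊆X x∈∁[Y∪e] with side S (λ { refl → x∈∁p⇒x∉p x∈∁[Y∪e] (q⊆p∪q Y ⁅ e ⁆ (x∈⁅x⁆ e)) })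
    ... | inj₁ x∈X = x∈X
    ... | inj₂ x∈Y = ⊥-elim (x∈∁p⇒x∉p x∈∁[Y∪e] (p⊆p∪q ⁅ e ⁆ x∈Y))
    r[∁[Y∪e]]<r⊤ : r M (∁ (Y ∪ ⁅ e ⁆)) < r M ⊤
    r[∁[Y∪e]]<r⊤ = ≤-<-trans (r-mono-⊆ M ∁[Y∪e]⊆X) r[X]<r⊤

  2≤∣Y-y∣ : 2-Separation X Y → ∀ y → 2 ≤ ∣ Y - y ∣
  2≤∣Y-y∣ {Y = Y} S y = ≤-pred (≤-trans (2-separation-wide S) (∣p∣≤1+∣p-x∣ Y y))

  ¬2-separation-fgh-together : 2-Separation X Y → f ∈ X → g ∈ X → h ∈ X → ⊥
  ¬2-separation-fgh-together S f∈X g∈X h∈X =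
    ¬separation (s≤s z≤n) ≤-refl
      (extend-by-deleted M S (e-spanned f∈X g∈X h∈X) z≤n (Separation.k≤∣Y∣ S))

  ¬2-separation-f-apart : 2-Separation X Y → g ∈ X → h ∈ X → f ∈ Y → ⊥
  ¬2-separation-f-apart {X = X} {Y = Y} S g∈X h∈X f∈Y =
    ¬Separation (contractRank-mono-⊆ M f) M/f-3conn (s≤s z≤n) ≤-refl
      (contraction-separation M (remove-contracted (add-deleted partition) f∈Y)
        (≤-trans k≤∣X∣ (∣p∣≤∣p∪q∣ X ⁅ e ⁆)) (2≤∣Y-y∣ S f) rank-bound)
    where
    open Separation S
    X∪e : Subset n
    X∪e = X ∪ ⁅ e ⁆
    e∈X∪e : e ∈ X∪e
    e∈X∪e = q⊆p∪q X ⁅ e ⁆ (x∈⁅x⁆ e)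
    rank-bound : r M (X∪e ∪ ⁅ f ⁆) + r M ((Y - f) ∪ ⁅ f ⁆) < r M ⁅ f ⁆ + (r M ⊤ + 2)
    rank-bound = begin-strict
      r M (X∪e ∪ ⁅ f ⁆) + r M ((Y - f) ∪ ⁅ f ⁆)
        ≤⟨ +-mono-≤ (≤-trans (f-spanned e∈X∪e (p⊆p∪q ⁅ e ⁆ g∈X) (p⊆p∪q ⁅ e ⁆ h∈X)) (r[X∪x]≤1+r[X] M X e))
                    (r-mono-⊆ M (p-x∪⁅x⁆⊆p f∈Y)) ⟩
      suc (r M X + r M Y) ≤⟨ ρX+ρY<ρE+k ⟩
      r M (∁ ⁅ e ⁆) + 2   ≤⟨ +-monoˡ-≤ 2 (r-mono-⊆ M ⊆⊤) ⟩
      r M ⊤ + 2           <⟨ n<1+n (r M ⊤ + 2) ⟩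
      1 + (r M ⊤ + 2)     ≤⟨ +-monoˡ-≤ (r M ⊤ + 2) f-nonloop ⟩
      r M ⁅ f ⁆ + (r M ⊤ + 2) ∎

  ¬2-separation-gh-together : 2-Separation X Y → g ∈ X → h ∈ X → ⊥
  ¬2-separation-gh-together S g∈X h∈X with side S (≢-sym e≢f)
  ... | inj₁ f∈X = ¬2-separation-fgh-together S f∈X g∈X h∈X
  ... | inj₂ f∈Y = ¬2-separation-f-apart S g∈X h∈X f∈Y

  T-meeting-once⇒coloop : ∀ {w v} → w ∈ T → v ∈ T → v ≢ w → w ∈ W →
                          (∀ {x} → x ∈ W → x ∈ T → x ≡ w) → r M (W - w) < r M W
  T-meeting-once⇒coloop w∈T v∈T v≢w =
    cocircuit-meeting-once⇒coloop M (proj₁ T-triad) w∈T (x∈p⇒0<∣p∣ (x∈p∧x≢y⇒x∈p-y v∈T v≢w))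

  ¬2-separation-gh-apart : 2-Separation X Y → g ∈ X → h ∈ Y → ⊥
  ¬2-separation-gh-apart {X = X} {Y = Y} S g∈X h∈Y
    with ∣T∣≡3⇒meets-a-side-once (proj₂ T-triad) (Partition.disjoint (Separation.partition S))
                                g∈X h∈Y g∈T h∈T
  ... | inj₁ X∩T⊆g = ¬2-separation-gh-together
          (move-coloop M (swap-separation S) g∈X
             (T-meeting-once⇒coloop g∈T h∈T (≢-sym g≢h) g∈X X∩T⊆g) (2≤∣Y-y∣ (swap-separation S) g))
          (q⊆p∪q Y ⁅ g ⁆ (x∈⁅x⁆ g)) (p⊆p∪q ⁅ g ⁆ h∈Y)
  ... | inj₂ Y∩T⊆h = ¬2-separation-gh-together
          (move-coloop M S h∈Y (T-meeting-once⇒coloop h∈T g∈T g≢h h∈Y Y∩T⊆h) (2≤∣Y-y∣ S h))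
          (p⊆p∪q ⁅ h ⁆ g∈X) (q⊆p∪q X ⁅ h ⁆ (x∈⁅x⁆ h))

  ¬2-separation : ¬ 2-Separation X Y
  ¬2-separation S with side S (≢-sym e≢g) | side S (≢-sym e≢h)
  ... | inj₁ g∈X | inj₁ h∈X = ¬2-separation-gh-together S g∈X h∈X
  ... | inj₂ g∈Y | inj₂ h∈Y = ¬2-separation-gh-together (swap-separation S) g∈Y h∈Y
  ... | inj₁ g∈X | inj₂ h∈Y = ¬2-separation-gh-apart S g∈X h∈Y
  ... | inj₂ g∈Y | inj₁ h∈X = ¬2-separation-gh-apart (swap-separation S) g∈Y h∈X

  ¬1-separation : ¬ Separation (r M) (∁ ⁅ e ⁆) 1 X Y
  ¬1-separation {X = X} {Y = Y} S with 2 ≤? ∣ Y ∣ | 2 ≤? ∣ X ∣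
  ... | yes 2≤∣Y∣ | _         =
    ¬separation (s≤s z≤n) ≤-refl (extend-by-deleted M S (r[X∪x]≤1+r[X] M X e) ≤-refl 2≤∣Y∣)
  ... | no _      | yes 2≤∣X∣ =
    ¬separation (s≤s z≤n) ≤-refl
      (extend-by-deleted M (swap-separation S) (r[X∪x]≤1+r[X] M Y e) ≤-refl 2≤∣X∣)
  ... | no 2≰∣Y∣  | no 2≰∣X∣  = 1+n≰n (begin
    3                   ≤⟨ unique-length≤∣p∣ distinct (∈X∪Y e≢f ∷ ∈X∪Y e≢g ∷ ∈X∪Y e≢h ∷ []) ⟩
    ∣ X ∪ Y ∣           ≤⟨ ∣p∪q∣≤∣p∣+∣q∣ X Y ⟩
    ∣ X ∣ + ∣ Y ∣       ≤⟨ +-mono-≤ (≤-pred (≰⇒> 2≰∣X∣)) (≤-pred (≰⇒> 2≰∣Y∣)) ⟩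
    2                   ∎)
    where
    ∈X∪Y : ∀ {x} → e ≢ x → x ∈ X ∪ Y
    ∈X∪Y e≢x = x∈p∪q⁺ (side S (≢-sym e≢x))
    distinct : Unique (f ∷ g ∷ h ∷ [])
    distinct = (f≢g ∷ f≢h ∷ []) ∷ (g≢h ∷ []) ∷ [] ∷ []

lemma5p3 : {n : ℕ} (M : Matroid n) (e f g h : Fin n) →
    ThreeConnected M →
    e ≢ f → e ≢ g → e ≢ h → f ≢ g → f ≢ h → g ≢ h →
    IsCircuit M (⁅ e ⁆ ∪ ⁅ f ⁆ ∪ ⁅ g ⁆ ∪ ⁅ h ⁆) →
    (∃ λ T → IsTriad M T × g ∈ T × h ∈ T) →
    (∀ T → IsTriad M T → e ∉ T) →
    ThreeConnectedCon M f →
    ThreeConnectedDel M e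
lemma5p3 M e f g h M-3conn e≢f e≢g e≢h f≢g f≢h g≢h C-circuit (T , T-triad , g∈T , h∈T)
         e∉triads M/f-3conn = M\e-3conn
  where
  open Lemma5p3 M M-3conn e≢f e≢g e≢h f≢g f≢h g≢h C-circuit T-triad g∈T h∈T e∉triads M/f-3conn
  M\e-3conn : ThreeConnectedDel M e
  M\e-3conn 1 X _ _ separation = ¬1-separation (IsSeparation⇒Separation separation)
  M\e-3conn 2 X _ _ separation = ¬2-separation (IsSeparation⇒Separation separation)
  M\e-3conn 0 X () _ _
  M\e-3conn (suc (suc (suc _))) X _ (s≤s (s≤s (s≤s ()))) _
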